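{- Let $k\ge 3$ and let $G$ be a fair complete $k$-partite graph. Then $G$ has a spanning subgraph which is a fair complete tripartite graph.
   Context: A complete $k$-partite graph has $k$ non-empty partition classes, with two vertices adjacent iff they lie in distinct classes. A multipartite graph on $n$ vertices is fair if no partition class contains more than $n/2$ vertices. -}

module Defs where

open import Data.Nat using (ℕ; _*_; _≤_)
open import Data.Fin using (Fin; _≟_)
open import Data.List using (length; filter; allFin)
open import Data.Product using (Σ; ∃; _×_)
open import Relation.Binary.PropositionalEquality using (_≡_; _≢_)
open import Relation.Nullary using (¬_)
open import Function.Bundles using (_⇔_)

record SimpleGraph (n : ℕ) : Set₁ where
  field
    Adj    : Fin n → Fin n → Set
    sym    : ∀ {u v} → Adj u v → Adj v u
    irrefl : ∀ {u} → ¬ Adj u u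
open SimpleGraph public

classSize : ∀ {n k} → (Fin n → Fin k) → Fin k → ℕ
classSize {n} c i = length (filter (λ v → c v ≟ i) (allFin n))

IsCompletePartition : ∀ {n} k → SimpleGraph n → (Fin n → Fin k) → Set
IsCompletePartition {n} k G c =
  (∀ (i : Fin k) → ∃ λ (v : Fin n) → c v ≡ i)
  × (∀ u v → (Adj G u v ⇔ (c u ≢ c v)))

IsFairPartition : ∀ {n k} → (Fin n → Fin k) → Set
IsFairPartition {n} {k} c = ∀ (i : Fin k) → 2 * classSize c i ≤ n

FairCompleteMultipartite : ∀ {n} → ℕ → SimpleGraph n → Set
FairCompleteMultipartite {n} k G =
  Σ (Fin n → Fin k) λ c → IsCompletePartition k G c × IsFairPartition c

IsSpanningSubgraph : ∀ {n} → SimpleGraph n → SimpleGraph n → Set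
IsSpanningSubgraph H G = ∀ u v → Adj H u v → Adj G u v

-- Merging classes of a complete multipartite graph only deletes edges, so it suffices to
-- coarsen a fair partition with k ≥ 4 classes to a fair one with k − 1 classes and iterate.
-- Four classes hold at most n vertices together, so the pair {0,1} or the pair {2,3} holds
-- at most n/2 of them; merging that pair keeps the partition fair.
module Submission where

open import Defs hiding (sym)
open import Data.Nat using (ℕ; zero; suc; _+_; _*_; _≤_; _≤?_; z≤n; s≤s)
open import Data.Nat.Properties
  using (module ≤-Reasoning; ≤-trans; ≤-reflexive; <⇒≱; +-mono-<; ≰⇒>; *-monoʳ-≤; *-distribˡ-+; +-suc; +-identityʳ)
open import Data.Fin using (Fin; zero; suc; _≟_; punchIn; punchOut)
open import Data.Fin.Properties
  using (punchOut-injective; punchOut-cong; punchOut-punchIn; punchIn-punchOut; punchInᵢ≢i)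
open import Data.List using ([]; _∷_; length; filter; allFin)
open import Data.List.Properties using (filter-≐; length-filter; length-tabulate)
open import Data.Product using (Σ; ∃; _×_; _,_)
open import Data.Sum using (_⊎_; inj₁; inj₂)
open import Function using (_∘_; id)
open import Function.Bundles using (mk⇔; Equivalence)
open import Level using (Level; 0ℓ)
open import Relation.Nullary using (¬_; Dec; yes; no; contradiction)
open import Relation.Unary using (Pred; Decidable; _≐_; _⊥_; _∪_)
open import Relation.Unary.Properties using (_∪?_)
open import Relation.Binary.PropositionalEquality
  using (_≡_; _≢_; refl; sym; trans; cong; cong₂; subst)

module _ {a p q : Level} {A : Set a} {P : Pred A p} {Q : Pred A q}
         (P? : Decidable P) (Q? : Decidable Q) where

  length-filter-∪ : P ⊥ Q → ∀ xs →
    length (filter (P? ∪? Q?) xs) ≡ length (filter P? xs) + length (filter Q? xs)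
  length-filter-∪ P⊥Q [] = refl
  length-filter-∪ P⊥Q (x ∷ xs) with P? x | Q? x
  ... | yes px | yes qx = contradiction (px , qx) P⊥Q
  ... | yes px | no ¬qx = cong suc (length-filter-∪ P⊥Q xs)
  ... | no ¬px | yes qx = trans (cong suc (length-filter-∪ P⊥Q xs)) (sym (+-suc _ _))
  ... | no ¬px | no ¬qx = length-filter-∪ P⊥Q xs

Onto : ∀ {n k} → (Fin n → Fin k) → Set
Onto {n} {k} c = ∀ (i : Fin k) → ∃ λ (v : Fin n) → c v ≡ i

Onto-∘ : ∀ {n k l} {g : Fin k → Fin l} {c : Fin n → Fin k} → Onto g → Onto c → Onto (g ∘ c)
Onto-∘ g-onto c-onto s with g-onto s
... | i , gi≡s with c-onto i
...   | v , cv≡i = v , trans (cong _ cv≡i) gi≡s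

module _ {n k : ℕ} (c : Fin n → Fin k) where

  -- classSize (g ∘ c) s is definitionally classesSize (λ i → g i ≟ s).
  classesSize : {S : Pred (Fin k) 0ℓ} → Decidable S → ℕ
  classesSize S? = length (filter (S? ∘ c) (allFin n))

  classesSize-cong : {S T : Pred (Fin k) 0ℓ} (S? : Decidable S) (T? : Decidable T) →
                     S ≐ T → classesSize S? ≡ classesSize T?
  classesSize-cong S? T? (S⊆T , T⊆S) = cong length (filter-≐ (S? ∘ c) (T? ∘ c) (S⊆T , T⊆S) (allFin n))

  classesSize-∪ : {S T : Pred (Fin k) 0ℓ} (S? : Decidable S) (T? : Decidable T) →
                  S ⊥ T → classesSize (S? ∪? T?) ≡ classesSize S? + classesSize T?
  classesSize-∪ S? T? S⊥T = length-filter-∪ (S? ∘ c) (T? ∘ c) S⊥T (allFin n)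

  classesSize≤n : {S : Pred (Fin k) 0ℓ} (S? : Decidable S) → classesSize S? ≤ n
  classesSize≤n S? = ≤-trans (length-filter (S? ∘ c) (allFin n)) (≤-reflexive (length-tabulate id))

  classSize-pair : {i j : Fin k} → i ≢ j →
                   classesSize ((_≟ i) ∪? (_≟ j)) ≡ classSize c i + classSize c j
  classSize-pair i≢j = classesSize-∪ (_≟ _) (_≟ _) λ (x≡i , x≡j) → i≢j (trans (sym x≡i) x≡j)

-- Class q is merged into class p; the remaining classes are renumbered by punchOut q.
mergeInto : ∀ {k} {p q : Fin (suc k)} → q ≢ p → Fin (suc k) → Fin k
mergeInto {q = q} q≢p x with q ≟ x
... | yes _   = punchOut q≢p
... | no q≢x = punchOut q≢x

module _ {k : ℕ} {p q : Fin (suc k)} (q≢p : q ≢ p) where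

  mergeInto-punchIn : ∀ s → mergeInto q≢p (punchIn q s) ≡ s
  mergeInto-punchIn s with q ≟ punchIn q s
  ... | yes q≡qs = contradiction (sym q≡qs) (punchInᵢ≢i q s)
  ... | no q≢qs = trans (punchOut-cong q refl) (punchOut-punchIn q)

  mergeInto-onto : Onto (mergeInto q≢p)
  mergeInto-onto s = punchIn q s , mergeInto-punchIn s

  mergeInto-fiber-merged : (λ x → mergeInto q≢p x ≡ punchOut q≢p) ≐ ((_≡ p) ∪ (_≡ q))
  mergeInto-fiber-merged = to , from
    where
    to : ∀ {x} → mergeInto q≢p x ≡ punchOut q≢p → x ≡ p ⊎ x ≡ q
    to {x} e with q ≟ x
    ... | yes q≡x = inj₂ (sym q≡x)
    ... | no q≢x = inj₁ (punchOut-injective q≢x q≢p e)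
    from : ∀ {x} → x ≡ p ⊎ x ≡ q → mergeInto q≢p x ≡ punchOut q≢p
    from {x} x∈pq with q ≟ x | x∈pq
    ... | yes _   | _        = refl
    ... | no q≢x | inj₁ x≡p = punchOut-cong q x≡p
    ... | no q≢x | inj₂ x≡q = contradiction (sym x≡q) q≢x

  mergeInto-fiber-other : ∀ {s} → s ≢ punchOut q≢p → (λ x → mergeInto q≢p x ≡ s) ≐ (_≡ punchIn q s)
  mergeInto-fiber-other {s} s≢pq = to , λ { refl → mergeInto-punchIn s }
    where
    to : ∀ {x} → mergeInto q≢p x ≡ s → x ≡ punchIn q s
    to {x} e with q ≟ x
    ... | yes _   = contradiction (sym e) s≢pq
    ... | no q≢x = trans (sym (punchIn-punchOut q≢x)) (cong (punchIn q) e)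

  mergeInto-fair : ∀ {n} (c : Fin n → Fin (suc k)) → IsFairPartition c →
                   2 * (classSize c p + classSize c q) ≤ n →
                   IsFairPartition (mergeInto q≢p ∘ c)
  mergeInto-fair {n} c c-fair pq-fair s with s ≟ punchOut q≢p
  ... | yes refl = subst (λ m → 2 * m ≤ n) (sym size≡) pq-fair
    where
    size≡ : classSize (mergeInto q≢p ∘ c) s ≡ classSize c p + classSize c q
    size≡ = trans (classesSize-cong c (λ x → mergeInto q≢p x ≟ s) ((_≟ p) ∪? (_≟ q)) mergeInto-fiber-merged)
                  (classSize-pair c (λ p≡q → q≢p (sym p≡q)))
  ... | no s≢pq = subst (λ m → 2 * m ≤ n) (sym size≡) (c-fair (punchIn q s))
    where
    size≡ : classSize (mergeInto q≢p ∘ c) s ≡ classSize c (punchIn q s)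
    size≡ = classesSize-cong c (λ x → mergeInto q≢p x ≟ s) (_≟ punchIn q s) (mergeInto-fiber-other s≢pq)

twice-≤-complement : ∀ {n} x y → x + y ≤ n → ¬ (2 * x ≤ n) → 2 * y ≤ n
twice-≤-complement {n} x y x+y≤n 2x≰n with 2 * y ≤? n
... | yes 2y≤n = 2y≤n
... | no 2y≰n = contradiction 2x+2y≤n+n (<⇒≱ (+-mono-< (≰⇒> 2x≰n) (≰⇒> 2y≰n)))
  where
  open ≤-Reasoning
  2x+2y≤n+n : 2 * x + 2 * y ≤ n + n
  2x+2y≤n+n = begin
    2 * x + 2 * y ≡⟨ *-distribˡ-+ 2 x y ⟨
    2 * (x + y)   ≤⟨ *-monoʳ-≤ 2 x+y≤n ⟩
    2 * n         ≡⟨ cong (n +_) (+-identityʳ n) ⟩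
    n + n         ∎

pattern 0F = zero
pattern 1F = suc zero
pattern 2F = suc (suc zero)
pattern 3F = suc (suc (suc zero))

first-four-classes≤n : ∀ {n m} (c : Fin n → Fin (4 + m)) →
  (classSize c 0F + classSize c 1F) + (classSize c 2F + classSize c 3F) ≤ n
first-four-classes≤n {n} c = subst (_≤ n) sizes≡ (classesSize≤n c (01? ∪? 23?))
  where
  01? = (_≟ 0F) ∪? (_≟ 1F)
  23? = (_≟ 2F) ∪? (_≟ 3F)
  01⊥23 : ((_≡ 0F) ∪ (_≡ 1F)) ⊥ ((_≡ 2F) ∪ (_≡ 3F))
  01⊥23 (inj₁ refl , inj₁ ())
  01⊥23 (inj₁ refl , inj₂ ())
  01⊥23 (inj₂ refl , inj₁ ())
  01⊥23 (inj₂ refl , inj₂ ())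
  sizes≡ : classesSize c (01? ∪? 23?) ≡ (classSize c 0F + classSize c 1F) + (classSize c 2F + classSize c 3F)
  sizes≡ = trans (classesSize-∪ c 01? 23? 01⊥23)
                 (cong₂ _+_ (classSize-pair c (λ ())) (classSize-pair c (λ ())))

fair-merge : ∀ {n m} (c : Fin n → Fin (4 + m)) → IsFairPartition c →
             Σ (Fin (4 + m) → Fin (3 + m)) λ g → Onto g × IsFairPartition (g ∘ c)
fair-merge {n} {m} c c-fair = merge-light-pair (2 * size01 ≤? n)
  where
  size01 size23 : ℕ
  size01 = classSize c 0F + classSize c 1F
  size23 = classSize c 2F + classSize c 3F
  1≢0 : 1F ≢ 0F
  1≢0 ()
  3≢2 : 3F ≢ 2F
  3≢2 ()
  merge-light-pair : Dec (2 * size01 ≤ n) →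
                     Σ (Fin (4 + m) → Fin (3 + m)) λ g → Onto g × IsFairPartition (g ∘ c)
  merge-light-pair (yes 01-fair) =
    mergeInto 1≢0 , mergeInto-onto 1≢0 , mergeInto-fair 1≢0 c c-fair 01-fair
  merge-light-pair (no 01-unfair) =
    mergeInto 3≢2 , mergeInto-onto 3≢2 ,
    mergeInto-fair 3≢2 c c-fair (twice-≤-complement size01 size23 (first-four-classes≤n c) 01-unfair)

fair-coarsening : ∀ m {n} (c : Fin n → Fin (3 + m)) → IsFairPartition c →
                  Σ (Fin (3 + m) → Fin 3) λ f → Onto f × IsFairPartition (f ∘ c)
fair-coarsening zero    c c-fair = id , (λ i → i , refl) , c-fair
fair-coarsening (suc m) c c-fair with fair-merge c c-fair
... | g , g-onto , gc-fair with fair-coarsening m (g ∘ c) gc-fair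
...   | f , f-onto , fgc-fair = f ∘ g , Onto-∘ f-onto g-onto , fgc-fair

completeMultipartite : ∀ {n k} → (Fin n → Fin k) → SimpleGraph n
completeMultipartite c = record
  { Adj    = λ u v → c u ≢ c v
  ; sym    = λ cu≢cv cv≡cu → cu≢cv (sym cv≡cu)
  ; irrefl = λ cu≢cu → cu≢cu refl
  }

completeMultipartite-isCompletePartition : ∀ {n k} (c : Fin n → Fin k) → Onto c →
  IsCompletePartition k (completeMultipartite c) c
completeMultipartite-isCompletePartition c c-onto = c-onto , λ u v → mk⇔ id id

coarsening-isSpanningSubgraph : ∀ {n k l} (G : SimpleGraph n) (c : Fin n → Fin k) →
  IsCompletePartition k G c → (f : Fin k → Fin l) →
  IsSpanningSubgraph (completeMultipartite (f ∘ c)) G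
coarsening-isSpanningSubgraph G c (_ , G-adj) f u v fcu≢fcv =
  Equivalence.from (G-adj u v) (λ cu≡cv → fcu≢fcv (cong f cu≡cv))

lemma1p8 : (n k : ℕ) → 3 ≤ k → (G : SimpleGraph n) →
    FairCompleteMultipartite k G →
    Σ (SimpleGraph n) λ H → IsSpanningSubgraph H G × FairCompleteMultipartite 3 H
lemma1p8 n (suc (suc (suc m))) (s≤s (s≤s (s≤s z≤n))) G (c , G-complete@(c-onto , _) , c-fair)
  with fair-coarsening m c c-fair
... | f , f-onto , fc-fair =
  completeMultipartite (f ∘ c) ,
  coarsening-isSpanningSubgraph G c G-complete f ,
  (f ∘ c , completeMultipartite-isCompletePartition (f ∘ c) (Onto-∘ f-onto c-onto) , fc-fair)
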